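{- Let $w\in\mathfrak S_n$. The subsequence of $w$ formed by its $k$-peaks and $k$-valleys (in the order in which they appear in $w$) is a longest $k$-zigzagging subsequence of $w$. Consequently, the average $k$-zigzagging length $E_n(zs_k)=\frac{1}{n!}\sum_{w\in\mathfrak S_n}zs_k(w)$ equals two times the average number of $k$-peaks of permutations in $\mathfrak S_n$.
   Context: Let $n\ge2$, $1\le k\le n-1$, and $\mathfrak S_n$ the permutations of $\{1,\dots,n\}$ in one-line notation $w=w_1\cdots w_n$. A section of $w$ is a consecutive segment $w_sw_{s+1}\cdots w_t$. A section $w_i\cdots w_j$ with $i<j$ is $k$-ascending if (1) $w_i=\min\{w_i,\dots,w_j\}$ and $w_j=\max\{w_i,\dots,w_j\}$; (2) $w_j-w_i\ge k$; (3) there are no $i\le s<t\le j$ with $w_s-w_t\ge k$. It is $k$-descending if (1) $w_i=\max\{w_i,\dots,w_j\}$ and $w_j=\min\{w_i,\dots,w_j\}$; (2) $w_i-w_j\ge k$; (3) there are no $i\le s<t\le j$ with $w_t-w_s\ge k$. A $k$-ascending (resp. $k$-descending) section is maximal if it is not contained in another $k$-ascending (resp. $k$-descending) section. If $w_i\cdots w_j$ is a maximal $k$-ascending section, $w_i$ is called a $k$-valley and $w_j$ a $k$-peak of $w$; if $w_i\cdots w_j$ is a maximal $k$-descending section, $w_i$ is called a $k$-peak and $w_j$ a $k$-valley of $w$. A subsequence $w_{i_1}\cdots w_{i_s}$ ($i_1<\dots<i_s$) is zigzagging if $w_{i_1}>w_{i_2}<w_{i_3}>\cdots$ or $w_{i_1}<w_{i_2}>w_{i_3}<\cdots$,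 and $k$-zigzagging if moreover $|w_{i_j}-w_{i_{j+1}}|\ge k$ for all $1\le j<s$. $zs_k(w)$ is the maximal length of a $k$-zigzagging subsequence of $w$. -}

module Defs where

open import Data.Nat using (ℕ; zero; suc; _+_; _*_; _≤_; _<_; ∣_-_∣)
open import Data.Fin as F using (Fin; toℕ)
open import Data.List using (List; []; _∷_; length; lookup; map; applyUpTo)
open import Data.List.Relation.Binary.Permutation.Propositional using (_↭_)
open import Data.List.Relation.Unary.Linked using (Linked)
open import Data.List.Relation.Unary.All using (All)
open import Data.List.Relation.Unary.Unique.Propositional using (Unique)
open import Data.List.Membership.Propositional using (_∈_)
open import Data.Product using (_×_; ∃; Σ)
open import Data.Sum using (_⊎_)
open import Data.Unit using (⊤)
open import Data.Bool using (Bool; true; false)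
open import Relation.Nullary using (¬_)
open import Relation.Binary.PropositionalEquality using (_≡_)
open import Function.Bundles using (_⇔_)

-- A permutation of {1,…,n} in one-line notation w₁⋯wₙ, as a list of naturals.
IsPerm : ℕ → List ℕ → Set
IsPerm n w = w ↭ applyUpTo suc n

Pos : List ℕ → Set
Pos w = Fin (length w)

_!_ : (w : List ℕ) → Pos w → ℕ
w ! i = lookup w i

_≤ₚ_ : {w : List ℕ} → Pos w → Pos w → Set
i ≤ₚ j = toℕ i ≤ toℕ j

_<ₚ_ : {w : List ℕ} → Pos w → Pos w → Set
i <ₚ j = toℕ i < toℕ j

KAscending : ℕ → (w : List ℕ) → Pos w → Pos w → Set
KAscending k w i j =
  _<ₚ_ {w} i j
  × (∀ s → _≤ₚ_ {w} i s → _≤ₚ_ {w} s j → (w ! i ≤ w ! s) × (w ! s ≤ w ! j))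
  × (w ! i + k ≤ w ! j)
  × (∀ s t → _≤ₚ_ {w} i s → _<ₚ_ {w} s t → _≤ₚ_ {w} t j → ¬ (w ! t + k ≤ w ! s))

KDescending : ℕ → (w : List ℕ) → Pos w → Pos w → Set
KDescending k w i j =
  _<ₚ_ {w} i j
  × (∀ s → _≤ₚ_ {w} i s → _≤ₚ_ {w} s j → (w ! s ≤ w ! i) × (w ! j ≤ w ! s))
  × (w ! j + k ≤ w ! i)
  × (∀ s t → _≤ₚ_ {w} i s → _<ₚ_ {w} s t → _≤ₚ_ {w} t j → ¬ (w ! s + k ≤ w ! t))

MaxKAscending : ℕ → (w : List ℕ) → Pos w → Pos w → Set
MaxKAscending k w i j =
  KAscending k w i j
  × (∀ i' j' → _≤ₚ_ {w} i' i → _≤ₚ_ {w} j j' → KAscending k w i' j' → (i' ≡ i) × (j' ≡ j))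

MaxKDescending : ℕ → (w : List ℕ) → Pos w → Pos w → Set
MaxKDescending k w i j =
  KDescending k w i j
  × (∀ i' j' → _≤ₚ_ {w} i' i → _≤ₚ_ {w} j j' → KDescending k w i' j' → (i' ≡ i) × (j' ≡ j))

KPeak : ℕ → (w : List ℕ) → Pos w → Set
KPeak k w p = (∃ λ i → MaxKAscending k w i p) ⊎ (∃ λ j → MaxKDescending k w p j)

KValley : ℕ → (w : List ℕ) → Pos w → Set
KValley k w p = (∃ λ j → MaxKAscending k w p j) ⊎ (∃ λ i → MaxKDescending k w i p)

IsSubseq : (w : List ℕ) → List (Pos w) → Set
IsSubseq w is = Linked (_<ₚ_ {w}) is

AltFrom : Bool → List ℕ → Set
AltFrom _ [] = ⊤
AltFrom _ (x ∷ []) = ⊤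
AltFrom true  (x ∷ y ∷ r) = (y < x) × AltFrom false (y ∷ r)
AltFrom false (x ∷ y ∷ r) = (x < y) × AltFrom true (y ∷ r)
  where import Data.Bool

Zigzagging : List ℕ → Set
Zigzagging xs = AltFrom true xs ⊎ AltFrom false xs

KGaps : ℕ → List ℕ → Set
KGaps k [] = ⊤
KGaps k (x ∷ []) = ⊤
KGaps k (x ∷ y ∷ r) = (k ≤ ∣ x - y ∣) × KGaps k (y ∷ r)

KZigzagging : ℕ → List ℕ → Set
KZigzagging k xs = Zigzagging xs × KGaps k xs

KZigzagSubseq : ℕ → (w : List ℕ) → List (Pos w) → Set
KZigzagSubseq k w is = IsSubseq w is × KZigzagging k (map (w !_) is)

IsZs : ℕ → List ℕ → ℕ → Set
IsZs k w m =
  (Σ (List (Pos w)) λ is → KZigzagSubseq k w is × length is ≡ m)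
  × (∀ is → KZigzagSubseq k w is → length is ≤ m)

IsNumKPeaks : ℕ → List ℕ → ℕ → Set
IsNumKPeaks k w m =
  Σ (List (Pos w)) λ ps → Unique ps × (∀ p → (p ∈ ps) ⇔ KPeak k w p) × length ps ≡ m

EnumeratesSn : ℕ → List (List ℕ) → Set
EnumeratesSn n L = All (IsPerm n) L × Unique L × (∀ w → IsPerm n w → w ∈ L)

-- Call the endpoints of maximal k-ascending and k-descending sections turning points; these are
-- exactly the k-peaks and k-valleys. Distinct maximal sections overlap at most in a shared endpoint, and
-- after a maximal section either a section of the opposite direction starts at its end or everything
-- later stays within k of it. Hence consecutive turning points are joined by maximal sections of
-- alternating directions, and the turning points form a k-zigzagging subsequence. Conversely, a
-- k-step of a zigzag cannot run against the section it lies in, so the number of turning points still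
-- usable by the rest of the zigzag strictly drops with every step: no k-zigzag is longer.
-- Complementing values, x ↦ n + 1 − x, permutes 𝔖ₙ and exchanges k-peaks and k-valleys, so summing
-- zs_k = #k-peaks + #k-valleys over 𝔖ₙ gives twice the total number of k-peaks.
module Submission where

open import Data.Bool using (Bool; true; false; not; if_then_else_; _xor_)
open import Data.Empty using (⊥; ⊥-elim)
open import Data.Fin as Fin using (Fin; toℕ)
open import Data.Fin.Properties using (toℕ-injective; toℕ<n; toℕ-cast; cast-is-id; cast-involutive; any?; all?)
open import Data.List using (List; []; _∷_; length; map; lookup; filter; allFin; tabulate; applyUpTo; _++_)
open import Data.List.Membership.Propositional using (_∈_)
open import Data.List.Membership.Propositional.Properties
  using (∈-applyUpTo⁺; ∈-applyUpTo⁻; ∈-map⁺; ∈-map⁻; ∈-lookup; ∈-filter⁺; ∈-filter⁻; ∈-allFin; ∈-++⁺ˡ; ∈-++⁺ʳ; ∈-++⁻)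
open import Data.List.Membership.Propositional.Properties.WithK using (unique∧set⇒bag)
open import Data.List.Properties using (length-map; length-++; map-∘; map-cong-local; map-id-local)
open import Data.List.Relation.Binary.BagAndSetEquality using (∼bag⇒↭)
open import Data.List.Relation.Binary.Permutation.Propositional using (_↭_; ↭-sym; ↭⇒↭ₛ)
open import Data.List.Relation.Binary.Permutation.Propositional.Properties
  using (∈-resp-↭; ↭-length) renaming (map⁺ to ↭-map⁺)
open import Data.List.Relation.Binary.Permutation.Setoid.Properties using (Unique-resp-↭)
open import Data.List.Relation.Unary.All as All using (All; []; _∷_)
open import Data.List.Relation.Unary.AllPairs using (_∷_)
open import Data.List.Relation.Unary.Any as Any using (here; there)
open import Data.List.Relation.Unary.Any.Properties using (lookup-index)
open import Data.List.Relation.Unary.Linked using (Linked; []; [-]; _∷_)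
import Data.List.Relation.Unary.Linked.Properties as LinkedP
open import Data.List.Relation.Unary.Unique.Propositional using (Unique)
import Data.List.Relation.Unary.Unique.Propositional.Properties as UniqueP
open import Data.Nat using (ℕ; zero; suc; _+_; _*_; _≤_; _<_; _∸_; z≤n; s≤s; _<?_; _≤?_; ∣_-_∣)
open import Data.Nat.ListAction using (sum)
open import Data.Nat.ListAction.Properties using (sum-↭)
open import Data.Nat.Properties
import Data.Product
open import Data.Product using (_×_; _,_; proj₁; proj₂; Σ; ∃; ∃₂; ∃-syntax)
import Data.Sum
open import Data.Sum using (_⊎_; inj₁; inj₂; [_,_])
open import Data.Unit using (⊤; tt)
open import Function using (_∘_; _$_; id)
open import Function.Bundles using (_⇔_; Equivalence; mk⇔)
open import Function.Properties.Equivalence using () renaming (trans to ⇔-trans; sym to ⇔-sym)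
open import Relation.Binary using (tri<; tri≈; tri>)
open import Relation.Binary.PropositionalEquality
  using (_≡_; refl; sym; trans; cong; cong₂; subst; subst₂; setoid; module ≡-Reasoning)
open import Relation.Nullary using (¬_; Dec; yes; no)
open import Relation.Nullary.Decidable using (decidable-stable; _×-dec_; _⊎-dec_; _→-dec_; ¬?)
open import Relation.Unary using (Decidable)

open import Defs

m+o≤n⇒o≤∣m-n∣ : ∀ {m n o} → m + o ≤ n → o ≤ ∣ m - n ∣
m+o≤n⇒o≤∣m-n∣ {m} {n} {o} m+o≤n = begin
  o          ≤⟨ m+n≤o⇒m≤o∸n o (subst (_≤ n) (+-comm m o) m+o≤n) ⟩
  n ∸ m      ≡⟨ sym (m≤n⇒∣m-n∣≡n∸m (m+n≤o⇒m≤o m m+o≤n)) ⟩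
  ∣ m - n ∣  ∎
  where open ≤-Reasoning

m≤n∧o≤∣m-n∣⇒m+o≤n : ∀ {m n o} → m ≤ n → o ≤ ∣ m - n ∣ → m + o ≤ n
m≤n∧o≤∣m-n∣⇒m+o≤n {m} {n} {o} m≤n o≤∣m-n∣ =
  subst (_≤ n) (+-comm o m) (m≤o∸n⇒m+n≤o o m≤n (subst (o ≤_) (m≤n⇒∣m-n∣≡n∸m m≤n) o≤∣m-n∣))

∸+≤∸⇒+≤ : ∀ {o m n} c → m ≤ o → n ≤ o → (o ∸ m) + c ≤ o ∸ n → n + c ≤ m
∸+≤∸⇒+≤ {o} {m} {n} c m≤o n≤o h = +-cancelˡ-≤ (o ∸ m) (n + c) m (begin
  (o ∸ m) + (n + c)  ≡⟨ cong ((o ∸ m) +_) (+-comm n c) ⟩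
  (o ∸ m) + (c + n)  ≡⟨ +-assoc (o ∸ m) c n ⟨
  (o ∸ m) + c + n    ≤⟨ m≤o∸n⇒m+n≤o ((o ∸ m) + c) n≤o h ⟩
  o                  ≡⟨ m∸n+n≡m m≤o ⟨
  (o ∸ m) + m        ∎)
  where open ≤-Reasoning

+≤⇒∸+≤∸ : ∀ {o m n} c → m ≤ o → n + c ≤ m → (o ∸ m) + c ≤ o ∸ n
+≤⇒∸+≤∸ {o} {m} {n} c m≤o h = m+n≤o⇒m≤o∸n ((o ∸ m) + c) (begin
  (o ∸ m) + c + n    ≡⟨ +-assoc (o ∸ m) c n ⟩
  (o ∸ m) + (c + n)  ≡⟨ cong ((o ∸ m) +_) (+-comm c n) ⟩
  (o ∸ m) + (n + c)  ≤⟨ +-monoʳ-≤ (o ∸ m) h ⟩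
  (o ∸ m) + m        ≡⟨ m∸n+n≡m m≤o ⟩
  o                  ∎)
  where open ≤-Reasoning

cast-injective : ∀ {m m′} (eq : m ≡ m′) {i j : Fin m} → Fin.cast eq i ≡ Fin.cast eq j → i ≡ j
cast-injective eq {i} {j} cᵢ≡cⱼ = toℕ-injective (begin
  toℕ i               ≡⟨ toℕ-cast eq i ⟨
  toℕ (Fin.cast eq i) ≡⟨ cong toℕ cᵢ≡cⱼ ⟩
  toℕ (Fin.cast eq j) ≡⟨ toℕ-cast eq j ⟩
  toℕ j               ∎)
  where open ≡-Reasoning

tabulate-increasing : ∀ {m m′} (f : Fin m → Fin m′) → (∀ {i j} → toℕ i < toℕ j → toℕ (f i) < toℕ (f j)) →
                      Linked (λ i j → toℕ i < toℕ j) (tabulate f)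
tabulate-increasing {zero} f monotone = []
tabulate-increasing {suc zero} f monotone = [-]
tabulate-increasing {suc (suc m)} f monotone =
  monotone {Fin.zero} {Fin.suc Fin.zero} (s≤s z≤n) ∷ tabulate-increasing (f ∘ Fin.suc) (monotone ∘ s≤s)

unique-same-members⇒↭ : ∀ {A : Set} {xs ys : List A} → Unique xs → Unique ys → (∀ {x} → (x ∈ xs) ⇔ (x ∈ ys)) → xs ↭ ys
unique-same-members⇒↭ unique-xs unique-ys same = ∼bag⇒↭ (unique∧set⇒bag unique-xs unique-ys same)

lookup-map : ∀ {A B : Set} (h : A → B) xs (i : Fin (length (map h xs))) →
             lookup (map h xs) i ≡ h (lookup xs (Fin.cast (length-map h xs) i))
lookup-map h (x ∷ xs) Fin.zero = refl
lookup-map h (x ∷ xs) (Fin.suc i) = lookup-map h xs i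

sum-map-+ : ∀ {A : Set} (f g : A → ℕ) (xs : List A) → sum (map (λ x → f x + g x) xs) ≡ sum (map f xs) + sum (map g xs)
sum-map-+ f g [] = refl
sum-map-+ f g (x ∷ xs) = begin
  f x + g x + sum (map (λ x → f x + g x) xs)       ≡⟨ cong (f x + g x +_) (sum-map-+ f g xs) ⟩
  f x + g x + (sum (map f xs) + sum (map g xs))    ≡⟨ interchange (f x) (g x) (sum (map f xs)) (sum (map g xs)) ⟩
  f x + sum (map f xs) + (g x + sum (map g xs))    ∎
  where
    open ≡-Reasoning
    open import Algebra.Properties.CommutativeSemigroup +-commutativeSemigroup using (interchange)

lookup-injective : ∀ {A : Set} {xs : List A} → Unique xs → ∀ {i j} → lookup xs i ≡ lookup xs j → i ≡ j
lookup-injective (_ ∷ _) {Fin.zero} {Fin.zero} _ = refl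
lookup-injective (x∉xs ∷ _) {Fin.zero} {Fin.suc j} x≡xⱼ = ⊥-elim (All.lookup x∉xs (∈-lookup j) x≡xⱼ)
lookup-injective (x∉xs ∷ _) {Fin.suc i} {Fin.zero} xᵢ≡x = ⊥-elim (All.lookup x∉xs (∈-lookup i) (sym xᵢ≡x))
lookup-injective (_ ∷ unique) {Fin.suc i} {Fin.suc j} xᵢ≡xⱼ = cong Fin.suc (lookup-injective unique xᵢ≡xⱼ)

least-witness : ∀ {m} (Q : Fin m → Set) → Decidable Q →
  (∀ g → ¬ Q g) ⊎ ∃ λ f → Q f × (∀ g → toℕ g < toℕ f → ¬ Q g)
least-witness {zero} Q Q? = inj₁ λ ()
least-witness {suc m} Q Q? with Q? Fin.zero
... | yes q = inj₂ (Fin.zero , q , λ g ())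
... | no ¬q with least-witness (λ g → Q (Fin.suc g)) (λ g → Q? (Fin.suc g))
...   | inj₁ none = inj₁ λ { Fin.zero → ¬q ; (Fin.suc g) → none g }
...   | inj₂ (f , q , below) =
        inj₂ (Fin.suc f , q , λ { Fin.zero _ → ¬q ; (Fin.suc g) (s≤s g<f) → below g g<f })

greatest-witness : ∀ {m} (Q : Fin m → Set) → Decidable Q →
  (∀ g → ¬ Q g) ⊎ ∃ λ f → Q f × (∀ g → toℕ f < toℕ g → ¬ Q g)
greatest-witness {zero} Q Q? = inj₁ λ ()
greatest-witness {suc m} Q Q? with greatest-witness (λ g → Q (Fin.suc g)) (λ g → Q? (Fin.suc g))
... | inj₂ (f , q , above) = inj₂ (Fin.suc f , q , λ { (Fin.suc g) (s≤s f<g) → above g f<g })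
... | inj₁ none with Q? Fin.zero
...   | yes q = inj₂ (Fin.zero , q , λ { (Fin.suc g) _ → none g })
...   | no ¬q = inj₁ λ { Fin.zero → ¬q ; (Fin.suc g) → none g }

-- Sections are developed over abstract orders on positions and on values, so that each lemma also
-- yields its mirror images by reversing the positions or the values.
record PositionOrder (m : ℕ) : Set₁ where
  field
    _≼_ _≺_     : Fin m → Fin m → Set
    ≼-refl      : ∀ {i} → i ≼ i
    ≼-trans     : ∀ {i j l} → i ≼ j → j ≼ l → i ≼ l
    ≺⇒≼         : ∀ {i j} → i ≺ j → i ≼ j
    ≺-≼-trans   : ∀ {i j l} → i ≺ j → j ≼ l → i ≺ l
    ≼-≺-trans   : ∀ {i j l} → i ≼ j → j ≺ l → i ≺ l
    ≼⇒≡⊎≺       : ∀ {i j} → i ≼ j → i ≡ j ⊎ i ≺ j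
    ≼⊎≻         : ∀ i j → i ≼ j ⊎ j ≺ i
    _≼?_        : ∀ i j → Dec (i ≼ j)
    _≺?_        : ∀ i j → Dec (i ≺ j)
    first-after : (Q : Fin m → Set) → Decidable Q → (p : Fin m) →
                  (∀ g → p ≺ g → ¬ Q g) ⊎ ∃ λ f → p ≺ f × Q f × (∀ g → p ≺ g → g ≺ f → ¬ Q g)
    last-before : (Q : Fin m → Set) → Decidable Q → (p : Fin m) →
                  (∀ g → g ≺ p → ¬ Q g) ⊎ ∃ λ f → f ≺ p × Q f × (∀ g → g ≺ p → f ≺ g → ¬ Q g)

reverse : ∀ {m} → PositionOrder m → PositionOrder m
reverse P = record
  { _≼_ = λ i j → j ≼ i
  ; _≺_ = λ i j → j ≺ i
  ; ≼-refl = ≼-refl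
  ; ≼-trans = λ j≼i l≼j → ≼-trans l≼j j≼i
  ; ≺⇒≼ = ≺⇒≼
  ; ≺-≼-trans = λ j≺i l≼j → ≼-≺-trans l≼j j≺i
  ; ≼-≺-trans = λ j≼i l≺j → ≺-≼-trans l≺j j≼i
  ; ≼⇒≡⊎≺ = λ j≼i → Data.Sum.map₁ sym (≼⇒≡⊎≺ j≼i)
  ; ≼⊎≻ = λ i j → ≼⊎≻ j i
  ; _≼?_ = λ i j → j ≼? i
  ; _≺?_ = λ i j → j ≺? i
  ; first-after = last-before
  ; last-before = first-after
  }
  where open PositionOrder P

forward : ∀ {m} → PositionOrder m
forward = record
  { _≼_ = λ i j → toℕ i ≤ toℕ j
  ; _≺_ = λ i j → toℕ i < toℕ j
  ; ≼-refl = ≤-refl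
  ; ≼-trans = ≤-trans
  ; ≺⇒≼ = <⇒≤
  ; ≺-≼-trans = <-≤-trans
  ; ≼-≺-trans = ≤-<-trans
  ; ≼⇒≡⊎≺ = ≤⇒≡⊎<
  ; ≼⊎≻ = λ i j → ≤-<-connex (toℕ i) (toℕ j)
  ; _≼?_ = λ i j → toℕ i ≤? toℕ j
  ; _≺?_ = λ i j → toℕ i <? toℕ j
  ; first-after = first-after
  ; last-before = last-before
  }
  where
    ≤⇒≡⊎< : ∀ {m} {i j : Fin m} → toℕ i ≤ toℕ j → i ≡ j ⊎ toℕ i < toℕ j
    ≤⇒≡⊎< i≤j with m≤n⇒m<n∨m≡n i≤j
    ... | inj₁ i<j = inj₂ i<j
    ... | inj₂ i≡j = inj₁ (toℕ-injective i≡j)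
    first-after : ∀ {m} (Q : Fin m → Set) → Decidable Q → (p : Fin m) →
      (∀ g → toℕ p < toℕ g → ¬ Q g) ⊎
      ∃ λ f → toℕ p < toℕ f × Q f × (∀ g → toℕ p < toℕ g → toℕ g < toℕ f → ¬ Q g)
    first-after Q Q? p with least-witness (λ g → toℕ p < toℕ g × Q g) (λ g → (toℕ p <? toℕ g) ×-dec Q? g)
    ... | inj₁ none = inj₁ λ g p<g q → none g (p<g , q)
    ... | inj₂ (f , (p<f , q) , below) = inj₂ (f , p<f , q , λ g p<g g<f q′ → below g g<f (p<g , q′))
    last-before : ∀ {m} (Q : Fin m → Set) → Decidable Q → (p : Fin m) →
      (∀ g → toℕ g < toℕ p → ¬ Q g) ⊎
      ∃ λ f → toℕ f < toℕ p × Q f × (∀ g → toℕ g < toℕ p → toℕ f < toℕ g → ¬ Q g)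
    last-before Q Q? p with greatest-witness (λ g → toℕ g < toℕ p × Q g) (λ g → (toℕ g <? toℕ p) ×-dec Q? g)
    ... | inj₁ none = inj₁ λ g g<p q → none g (g<p , q)
    ... | inj₂ (f , (f<p , q) , above) = inj₂ (f , f<p , q , λ g g<p f<g q′ → above g f<g (g<p , q′))

-- a ≪ b: b lies at least the gap beyond a, in the direction of ⊑.
record GapOrder : Set₁ where
  field
    _⊑_ _≪_   : ℕ → ℕ → Set
    ⊑-refl    : ∀ {a} → a ⊑ a
    ⊑-trans   : ∀ {a b c} → a ⊑ b → b ⊑ c → a ⊑ c
    ⊑-antisym : ∀ {a b} → a ⊑ b → b ⊑ a → a ≡ b
    ⋢⇒⊒       : ∀ {a b} → ¬ a ⊑ b → b ⊑ a
    ≪⇒⊑       : ∀ {a b} → a ≪ b → a ⊑ b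
    ⊑-≪-trans : ∀ {a b c} → a ⊑ b → b ≪ c → a ≪ c
    ≪-⊑-trans : ∀ {a b c} → a ≪ b → b ⊑ c → a ≪ c
    ≪-irrefl  : ∀ {a} → ¬ a ≪ a
    _⊑?_      : ∀ a b → Dec (a ⊑ b)
    _≪?_      : ∀ a b → Dec (a ≪ b)

module _ (k : ℕ) (1≤k : 1 ≤ k) where

  +-gap-irrefl : ∀ {a} → ¬ a + k ≤ a
  +-gap-irrefl {a} = <⇒≱ (m<m+n a 1≤k)

  upward : GapOrder
  upward = record
    { _⊑_ = _≤_
    ; _≪_ = λ a b → a + k ≤ b
    ; ⊑-refl = ≤-refl
    ; ⊑-trans = ≤-trans
    ; ⊑-antisym = ≤-antisym
    ; ⋢⇒⊒ = ≰⇒≥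
    ; ≪⇒⊑ = λ {a} a+k≤b → ≤-trans (m≤m+n a k) a+k≤b
    ; ⊑-≪-trans = λ a≤b b+k≤c → ≤-trans (+-monoˡ-≤ k a≤b) b+k≤c
    ; ≪-⊑-trans = ≤-trans
    ; ≪-irrefl = +-gap-irrefl
    ; _⊑?_ = _≤?_
    ; _≪?_ = λ a b → a + k ≤? b
    }

  downward : GapOrder
  downward = record
    { _⊑_ = λ a b → b ≤ a
    ; _≪_ = λ a b → b + k ≤ a
    ; ⊑-refl = ≤-refl
    ; ⊑-trans = λ b≤a c≤b → ≤-trans c≤b b≤a
    ; ⊑-antisym = λ b≤a a≤b → ≤-antisym a≤b b≤a
    ; ⋢⇒⊒ = ≰⇒≥
    ; ≪⇒⊑ = λ {a} {b} b+k≤a → ≤-trans (m≤m+n b k) b+k≤a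
    ; ⊑-≪-trans = λ b≤a c+k≤b → ≤-trans c+k≤b b≤a
    ; ≪-⊑-trans = λ b+k≤a c≤b → ≤-trans (+-monoˡ-≤ k c≤b) b+k≤a
    ; ≪-irrefl = +-gap-irrefl
    ; _⊑?_ = λ a b → b ≤? a
    ; _≪?_ = λ a b → b + k ≤? a
    }

module Sections {m : ℕ} (P : PositionOrder m) (V : GapOrder) (v : Fin m → ℕ) where
  open PositionOrder P
  open GapOrder V

  Rising : Fin m → Fin m → Set
  Rising i j = i ≺ j
    × (∀ s → i ≼ s → s ≼ j → v i ⊑ v s × v s ⊑ v j)
    × v i ≪ v j
    × (∀ s t → i ≼ s → s ≺ t → t ≼ j → ¬ v t ≪ v s)

  Falling : Fin m → Fin m → Set
  Falling i j = i ≺ j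
    × (∀ s → i ≼ s → s ≼ j → v s ⊑ v i × v j ⊑ v s)
    × v j ≪ v i
    × (∀ s t → i ≼ s → s ≺ t → t ≼ j → ¬ v s ≪ v t)

  Rising? : ∀ i j → Dec (Rising i j)
  Rising? i j = (i ≺? j)
    ×-dec all? (λ s → (i ≼? s) →-dec (s ≼? j) →-dec (v i ⊑? v s) ×-dec (v s ⊑? v j))
    ×-dec (v i ≪? v j)
    ×-dec all? (λ s → all? λ t → (i ≼? s) →-dec (s ≺? t) →-dec (t ≼? j) →-dec ¬? (v t ≪? v s))

  Stays : Fin m → Fin m → Set
  Stays p g = v g ⊑ v p × ¬ v g ≪ v p

  Stays? : ∀ p g → Dec (Stays p g)
  Stays? p g = (v g ⊑? v p) ×-dec ¬? (v g ≪? v p)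

  falling-to-first-drop : ∀ {p f} → p ≺ f → v f ≪ v p → (∀ g → p ≺ g → g ≺ f → Stays p g) →
                          Falling p f
  falling-to-first-drop {p} {f} p≺f drop stays = p≺f , bounds , drop , no-rise
    where
      bounds : ∀ s → p ≼ s → s ≼ f → v s ⊑ v p × v f ⊑ v s
      bounds s p≼s s≼f with ≼⇒≡⊎≺ s≼f | ≼⇒≡⊎≺ p≼s
      ... | inj₁ refl | _ = ≪⇒⊑ drop , ⊑-refl
      ... | inj₂ s≺f | inj₁ refl = ⊑-refl , ≪⇒⊑ drop
      ... | inj₂ s≺f | inj₂ p≺s =
            proj₁ (stays s p≺s s≺f) ,
            decidable-stable (v f ⊑? v s) (λ f⋢s → proj₂ (stays s p≺s s≺f) (⊑-≪-trans (⋢⇒⊒ f⋢s) drop))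
      no-rise : ∀ s t → p ≼ s → s ≺ t → t ≼ f → ¬ v s ≪ v t
      no-rise s t p≼s s≺t t≼f rise with ≼⇒≡⊎≺ p≼s
      ... | inj₁ refl = ≪-irrefl (≪-⊑-trans rise (proj₁ (bounds t (≼-trans p≼s (≺⇒≼ s≺t)) t≼f)))
      ... | inj₂ p≺s = proj₂ (stays s p≺s (≺-≼-trans s≺t t≼f))
                         (≪-⊑-trans rise (proj₁ (bounds t (≼-trans p≼s (≺⇒≼ s≺t)) t≼f)))

  rising-to-first-rise : ∀ {a p f} → Rising a p → p ≺ f → ¬ v f ⊑ v p →
                         (∀ g → p ≺ g → g ≺ f → Stays p g) → Rising a f
  rising-to-first-rise {a} {p} {f} (a≺p , bounds , gap , no-fall) p≺f f⋢p stays =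
    ≺-≼-trans a≺p (≺⇒≼ p≺f) , bounds′ , ≪-⊑-trans gap p⊑f , no-fall′
    where
      p⊑f : v p ⊑ v f
      p⊑f = ⋢⇒⊒ f⋢p
      below-p : ∀ {s} → a ≼ s → s ≺ f → v s ⊑ v p
      below-p {s} a≼s s≺f with ≼⊎≻ s p
      ... | inj₁ s≼p = proj₂ (bounds s a≼s s≼p)
      ... | inj₂ p≺s = proj₁ (stays s p≺s s≺f)
      bounds′ : ∀ s → a ≼ s → s ≼ f → v a ⊑ v s × v s ⊑ v f
      bounds′ s a≼s s≼f with ≼⊎≻ s p | ≼⇒≡⊎≺ s≼f
      ... | inj₁ s≼p | _ = proj₁ (bounds s a≼s s≼p) , ⊑-trans (proj₂ (bounds s a≼s s≼p)) p⊑f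
      ... | inj₂ _ | inj₁ refl = ⊑-trans (proj₁ (bounds p (≺⇒≼ a≺p) ≼-refl)) p⊑f , ⊑-refl
      ... | inj₂ p≺s | inj₂ s≺f =
            decidable-stable (v a ⊑? v s) (λ a⋢s → proj₂ (stays s p≺s s≺f) (⊑-≪-trans (⋢⇒⊒ a⋢s) gap)) ,
            ⊑-trans (below-p a≼s s≺f) p⊑f
      no-fall′ : ∀ s t → a ≼ s → s ≺ t → t ≼ f → ¬ v t ≪ v s
      no-fall′ s t a≼s s≺t t≼f fall with ≼⊎≻ t p | ≼⇒≡⊎≺ t≼f
      ... | inj₁ t≼p | _ = no-fall s t a≼s s≺t t≼p fall
      ... | inj₂ _ | inj₁ refl = f⋢p (≪⇒⊑ (≪-⊑-trans fall (below-p a≼s s≺t)))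
      ... | inj₂ p≺t | inj₂ t≺f = proj₂ (stays t p≺t t≺f) (≪-⊑-trans fall (below-p a≼s (≺-≼-trans s≺t (≺⇒≼ t≺f))))

  after-maximal-rise : ∀ {a p} → Rising a p → (∀ g → p ≺ g → ¬ Rising a g) →
                       (∀ g → p ≺ g → Stays p g) ⊎ ∃ (Falling p)
  after-maximal-rise {a} {p} rise maximal with first-after (λ g → ¬ Stays p g) (λ g → ¬? (Stays? p g)) p
  ... | inj₁ none = inj₁ λ g p≺g → decidable-stable (Stays? p g) (none g p≺g)
  ... | inj₂ (f , p≺f , escapes , before) = turn (v f ⊑? v p)
    where
      stays : ∀ g → p ≺ g → g ≺ f → Stays p g
      stays g p≺g g≺f = decidable-stable (Stays? p g) (before g p≺g g≺f)
      turn : Dec (v f ⊑ v p) → (∀ g → p ≺ g → Stays p g) ⊎ ∃ (Falling p)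
      turn (no f⋢p) = ⊥-elim (maximal f p≺f (rising-to-first-rise rise p≺f f⋢p stays))
      turn (yes f⊑p) = inj₂ (f , falling-to-first-drop p≺f drop stays)
        where
          drop : v f ≪ v p
          drop = decidable-stable (v f ≪? v p) λ ¬drop → escapes (f⊑p , ¬drop)

  rising-merge : ∀ {i j i′ j′} → Rising i j → Rising i′ j′ → i ≼ i′ → i′ ≼ j → j ≼ j′ → Rising i j′
  rising-merge {i} {j} {i′} {j′} (i≺j , bounds₁ , gap , no-fall₁) (_ , bounds₂ , _ , no-fall₂) i≼i′ i′≼j j≼j′ =
    ≺-≼-trans i≺j j≼j′ , bounds , ≪-⊑-trans gap j⊑j′ , no-fall
    where
      j⊑j′ : v j ⊑ v j′
      j⊑j′ = proj₂ (bounds₂ j i′≼j j≼j′)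
      bounds : ∀ s → i ≼ s → s ≼ j′ → v i ⊑ v s × v s ⊑ v j′
      bounds s i≼s s≼j′ with ≼⊎≻ s j
      ... | inj₁ s≼j = proj₁ (bounds₁ s i≼s s≼j) , ⊑-trans (proj₂ (bounds₁ s i≼s s≼j)) j⊑j′
      ... | inj₂ j≺s = ⊑-trans (proj₁ (bounds₁ i′ i≼i′ i′≼j)) (proj₁ (bounds₂ s i′≼s s≼j′)) ,
                       proj₂ (bounds₂ s i′≼s s≼j′)
        where i′≼s = ≼-trans i′≼j (≺⇒≼ j≺s)
      no-fall : ∀ s t → i ≼ s → s ≺ t → t ≼ j′ → ¬ v t ≪ v s
      no-fall s t i≼s s≺t t≼j′ fall with ≼⊎≻ t j | ≼⊎≻ i′ s
      ... | inj₁ t≼j | _ = no-fall₁ s t i≼s s≺t t≼j fall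
      ... | inj₂ j≺t | inj₁ i′≼s = no-fall₂ s t i′≼s s≺t t≼j′ fall
      ... | inj₂ j≺t | inj₂ s≺i′ =
            no-fall₁ s i′ i≼s s≺i′ i′≼j (⊑-≪-trans (proj₁ (bounds₂ t (≼-trans i′≼j (≺⇒≼ j≺t)) t≼j′)) fall)

  rising-falling-overlap : (∀ {i j} → v i ≡ v j → i ≡ j) →
                           ∀ {i j i′ j′} → Rising i j → Falling i′ j′ → i ≼ j′ → i′ ≼ j → i′ ≡ j ⊎ j′ ≡ i
  rising-falling-overlap v-injective {i} {j} {i′} {j′} (i≺j , bounds₁ , gap₁ , no-fall) (i′≺j′ , bounds₂ , gap₂ , no-rise)
                         i≼j′ i′≼j
    with ≼⊎≻ i i′ | ≼⊎≻ j j′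
  ... | inj₁ i≼i′ | inj₁ j≼j′ =
        inj₁ (v-injective (⊑-antisym (proj₂ (bounds₁ i′ i≼i′ i′≼j)) (proj₁ (bounds₂ j i′≼j j≼j′))))
  ... | inj₁ i≼i′ | inj₂ j′≺j = ⊥-elim (no-fall i′ j′ i≼i′ i′≺j′ (≺⇒≼ j′≺j) gap₂)
  ... | inj₂ i′≺i | inj₁ j≼j′ = ⊥-elim (no-rise i j (≺⇒≼ i′≺i) i≺j j≼j′ gap₁)
  ... | inj₂ i′≺i | inj₂ j′≺j =
        inj₂ (v-injective (⊑-antisym (proj₂ (bounds₂ i (≺⇒≼ i′≺i) i≼j′)) (proj₁ (bounds₁ j′ i≼j′ (≺⇒≼ j′≺j)))))

  rising-from-minimum : ∀ {a b} → (∀ g → v a ⊑ v g) → a ≺ b → v a ≪ v b → ∃ (Rising a)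
  rising-from-minimum {a} {b} minimum a≺b gap with first-after (λ g → v a ≪ v g) (λ g → v a ≪? v g) a
  ... | inj₁ none = ⊥-elim (none b a≺b gap)
  ... | inj₂ (f , a≺f , gap-f , before) = f , a≺f , bounds , gap-f , no-fall
    where
      bounds : ∀ s → a ≼ s → s ≼ f → v a ⊑ v s × v s ⊑ v f
      bounds s a≼s s≼f with ≼⇒≡⊎≺ s≼f | ≼⇒≡⊎≺ a≼s
      ... | inj₁ refl | _ = minimum s , ⊑-refl
      ... | inj₂ s≺f | inj₁ refl = minimum s , ≪⇒⊑ gap-f
      ... | inj₂ s≺f | inj₂ a≺s =
            minimum s , decidable-stable (v s ⊑? v f) (λ s⋢f → before s a≺s s≺f (≪-⊑-trans gap-f (⋢⇒⊒ s⋢f)))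
      no-fall : ∀ s t → a ≼ s → s ≺ t → t ≼ f → ¬ v t ≪ v s
      no-fall s t a≼s s≺t t≼f fall with ≼⇒≡⊎≺ a≼s
      ... | inj₁ refl = ≪-irrefl (⊑-≪-trans (minimum t) fall)
      ... | inj₂ a≺s = before s a≺s (≺-≼-trans s≺t t≼f) (⊑-≪-trans (minimum t) fall)

module Mirror {m : ℕ} (P : PositionOrder m) (V : GapOrder) (v : Fin m → ℕ) where
  open Sections P V v public
  module Reversed = Sections (reverse P) V v

  falling⇒reversed-rising : ∀ {p q} → Falling p q → Reversed.Rising q p
  falling⇒reversed-rising (p≺q , bounds , gap , no-rise) =
    p≺q , (λ s q≽s s≽p → Data.Product.swap (bounds s s≽p q≽s)) , gap , λ s t q≽s s≻t t≽p → no-rise t s t≽p s≻t q≽s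

  reversed-rising⇒falling : ∀ {p q} → Reversed.Rising q p → Falling p q
  reversed-rising⇒falling (p≺q , bounds , gap , no-fall) =
    p≺q , (λ s p≼s s≼q → Data.Product.swap (bounds s s≼q p≼s)) , gap , λ s t p≼s s≺t t≼q → no-fall t s t≼q s≺t p≼s

  reversed-falling⇒rising : ∀ {p f} → Reversed.Falling p f → Rising f p
  reversed-falling⇒rising (f≺p , bounds , gap , no-rise) =
    f≺p , (λ s f≼s s≼p → Data.Product.swap (bounds s s≼p f≼s)) , gap , λ s t f≼s s≺t t≼p → no-rise t s t≼p s≺t f≼s

module Relabel {m : ℕ} (P : PositionOrder m) (V V′ : GapOrder) (v v′ : Fin m → ℕ)
               (⊑-to : ∀ {i j} → GapOrder._⊑_ V (v i) (v j) → GapOrder._⊑_ V′ (v′ i) (v′ j))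
               (≪-to : ∀ {i j} → GapOrder._≪_ V (v i) (v j) → GapOrder._≪_ V′ (v′ i) (v′ j))
               (≪-from : ∀ {i j} → GapOrder._≪_ V′ (v′ i) (v′ j) → GapOrder._≪_ V (v i) (v j)) where
  module S = Sections P V v
  module S′ = Sections P V′ v′

  rising : ∀ {i j} → S.Rising i j → S′.Rising i j
  rising (i≺j , bounds , gap , no-fall) =
    i≺j , (λ s i≼s s≼j → Data.Product.map ⊑-to ⊑-to (bounds s i≼s s≼j)) , ≪-to gap ,
    λ s t i≼s s≺t t≼j → no-fall s t i≼s s≺t t≼j ∘ ≪-from

  falling : ∀ {i j} → S.Falling i j → S′.Falling i j
  falling (i≺j , bounds , gap , no-rise) =
    i≺j , (λ s i≼s s≼j → Data.Product.map ⊑-to ⊑-to (bounds s i≼s s≼j)) , ≪-to gap ,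
    λ s t i≼s s≺t t≼j → no-rise s t i≼s s≺t t≼j ∘ ≪-from

Maximal : ∀ {m} → (Fin m → Fin m → Set) → Fin m → Fin m → Set
Maximal S i j = S i j × (∀ i′ j′ → toℕ i′ ≤ toℕ i → toℕ j ≤ toℕ j′ → S i′ j′ → i′ ≡ i × j′ ≡ j)

maximal-transfer : ∀ {m} {S S′ : Fin m → Fin m → Set} → (∀ {i j} → S i j → S′ i j) → (∀ {i j} → S′ i j → S i j) →
                   ∀ {i j} → Maximal S i j → Maximal S′ i j
maximal-transfer to from (s , maximal) = to s , λ i′ j′ i′≤i j≤j′ → maximal i′ j′ i′≤i j≤j′ ∘ from

module _ {m : ℕ} {S : Fin m → Fin m → Set} where

  maximal-right : ∀ {a p} → Maximal S a p → ∀ g → toℕ p < toℕ g → ¬ S a g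
  maximal-right (_ , maximal) g p<g s = <-irrefl (cong toℕ (sym (proj₂ (maximal _ g ≤-refl (<⇒≤ p<g) s)))) p<g

  maximal-left : ∀ {p q} → Maximal S p q → ∀ g → toℕ g < toℕ p → ¬ S g q
  maximal-left (_ , maximal) g g<p s = <-irrefl (cong toℕ (proj₁ (maximal g _ (<⇒≤ g<p) ≤-refl s))) g<p

module _ {m : ℕ} {S : Fin m → Fin m → Set} (S? : ∀ i j → Dec (S i j)) where

  StrictlyEnclosed : Fin m → Fin m → Set
  StrictlyEnclosed i j = ∃₂ λ i′ j′ → S i′ j′ × toℕ i′ ≤ toℕ i × toℕ j ≤ toℕ j′ × (toℕ i′ < toℕ i ⊎ toℕ j < toℕ j′)

  StrictlyEnclosed? : ∀ i j → Dec (StrictlyEnclosed i j)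
  StrictlyEnclosed? i j = any? λ i′ → any? λ j′ →
    S? i′ j′ ×-dec (toℕ i′ ≤? toℕ i) ×-dec (toℕ j ≤? toℕ j′) ×-dec ((toℕ i′ <? toℕ i) ⊎-dec (toℕ j <? toℕ j′))

  -- size bounds the measure toℕ i + (m ∸ toℕ j), which drops whenever the section is strictly enlarged.
  extend-within : ∀ size {i j} → toℕ i + (m ∸ toℕ j) ≤ size → S i j →
                  ∃₂ λ i′ j′ → toℕ i′ ≤ toℕ i × toℕ j ≤ toℕ j′ × Maximal S i′ j′
  extend-within zero {i} {j} small _ = ⊥-elim (<⇒≱ (≤-trans (m<n⇒0<n∸m (toℕ<n j)) (m≤n+m (m ∸ toℕ j) (toℕ i))) small)
  extend-within (suc size) {i} {j} small s with StrictlyEnclosed? i j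
  ... | yes (i′ , j′ , s′ , i′≤i , j≤j′ , strict)
      with extend-within size (≤-pred (≤-trans (measure-decreases strict) small)) s′
    where
      measure-decreases : toℕ i′ < toℕ i ⊎ toℕ j < toℕ j′ → toℕ i′ + (m ∸ toℕ j′) < toℕ i + (m ∸ toℕ j)
      measure-decreases (inj₁ i′<i) = +-mono-<-≤ i′<i (∸-monoʳ-≤ m j≤j′)
      measure-decreases (inj₂ j<j′) = +-mono-≤-< i′≤i (∸-monoʳ-< j<j′ (<⇒≤ (toℕ<n j′)))
  ...   | i″ , j″ , i″≤i′ , j′≤j″ , maximal = i″ , j″ , ≤-trans i″≤i′ i′≤i , ≤-trans j≤j′ j′≤j″ , maximal
  extend-within (suc size) {i} {j} small s | no not-enclosed = i , j , ≤-refl , ≤-refl , s , maximal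
    where
      maximal : ∀ i′ j′ → toℕ i′ ≤ toℕ i → toℕ j ≤ toℕ j′ → S i′ j′ → i′ ≡ i × j′ ≡ j
      maximal i′ j′ i′≤i j≤j′ s′ with toℕ i′ <? toℕ i | toℕ j <? toℕ j′
      ... | yes i′<i | _ = ⊥-elim (not-enclosed (i′ , j′ , s′ , i′≤i , j≤j′ , inj₁ i′<i))
      ... | no _ | yes j<j′ = ⊥-elim (not-enclosed (i′ , j′ , s′ , i′≤i , j≤j′ , inj₂ j<j′))
      ... | no i′≮i | no j≮j′ = toℕ-injective (≤-antisym i′≤i (≮⇒≥ i′≮i)) , toℕ-injective (≤-antisym (≮⇒≥ j≮j′) j≤j′)

  extend-to-maximal : ∀ {i j} → S i j → ∃₂ λ i′ j′ → toℕ i′ ≤ toℕ i × toℕ j ≤ toℕ j′ × Maximal S i′ j′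
  extend-to-maximal s = extend-within _ ≤-refl s

  Maximal? : ∀ i j → Dec (Maximal S i j)
  Maximal? i j = S? i j ×-dec all? λ i′ → all? λ j′ →
    (toℕ i′ ≤? toℕ i) →-dec (toℕ j ≤? toℕ j′) →-dec S? i′ j′ →-dec (i′ Fin.≟ i) ×-dec (j′ Fin.≟ j)

module Extrema {m : ℕ} (V : GapOrder) (v : Fin m → ℕ) where
  open Sections forward V v

  Peak : Fin m → Set
  Peak p = (∃ λ i → Maximal Rising i p) ⊎ (∃ λ j → Maximal Falling p j)

  Valley : Fin m → Set
  Valley p = (∃ λ j → Maximal Rising p j) ⊎ (∃ λ i → Maximal Falling i p)

module Complement (k : ℕ) (1≤k : 1 ≤ k) {m : ℕ} (C : ℕ) (f g : Fin m → ℕ)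
                  (g≡C∸f : ∀ i → g i ≡ C ∸ f i) (f≤C : ∀ i → f i ≤ C) where
  module Up-f = Extrema (upward k 1≤k) f
  module Up-g = Extrema (upward k 1≤k) g

  ≤-to : ∀ {i j} → g i ≤ g j → f j ≤ f i
  ≤-to {i} {j} h rewrite g≡C∸f i | g≡C∸f j = ∸-cancelʳ-≤ (f≤C j) h

  ≤-from : ∀ {i j} → f j ≤ f i → g i ≤ g j
  ≤-from {i} {j} h rewrite g≡C∸f i | g≡C∸f j = ∸-monoʳ-≤ C h

  gap-to : ∀ {i j} → g i + k ≤ g j → f j + k ≤ f i
  gap-to {i} {j} h rewrite g≡C∸f i | g≡C∸f j = ∸+≤∸⇒+≤ k (f≤C i) (f≤C j) h

  gap-from : ∀ {i j} → f j + k ≤ f i → g i + k ≤ g j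
  gap-from {i} {j} h rewrite g≡C∸f i | g≡C∸f j = +≤⇒∸+≤∸ k (f≤C i) h

  module To = Relabel forward (upward k 1≤k) (downward k 1≤k) g f ≤-to gap-to gap-from
  module From = Relabel forward (downward k 1≤k) (upward k 1≤k) f g ≤-from gap-from gap-to

  -- Descending in f is ascending in g.
  peak⇔valley : ∀ p → Up-g.Peak p ⇔ Up-f.Valley p
  peak⇔valley p = mk⇔ to from
    where
      to : Up-g.Peak p → Up-f.Valley p
      to (inj₁ (i , max)) = inj₂ (i , maximal-transfer To.rising From.rising max)
      to (inj₂ (j , max)) = inj₁ (j , maximal-transfer To.falling From.falling max)
      from : Up-f.Valley p → Up-g.Peak p
      from (inj₁ (j , max)) = inj₂ (j , maximal-transfer From.falling To.falling max)
      from (inj₂ (i , max)) = inj₁ (i , maximal-transfer From.rising To.rising max)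

complement-peak⇔valley : ∀ k (1≤k : 1 ≤ k) {m m′} (eq : m′ ≡ m) C (f : Fin m → ℕ) (g : Fin m′ → ℕ) →
                         (∀ i → g i ≡ C ∸ f (Fin.cast eq i)) → (∀ i → f i ≤ C) →
                         ∀ p → Extrema.Peak (upward k 1≤k) g p ⇔ Extrema.Valley (upward k 1≤k) f (Fin.cast eq p)
complement-peak⇔valley k 1≤k refl C f g g≡C∸f f≤C p rewrite cast-is-id refl p =
  Complement.peak⇔valley k 1≤k C f g (λ i → trans (g≡C∸f i) (cong (λ j → C ∸ f j) (cast-is-id refl i))) f≤C p

-- A Bool d names a direction as in AltFrom: true is descending, false ascending.
module Zigzag (k : ℕ) (1≤k : 1 ≤ k) (w : List ℕ) (injective : ∀ {i j} → w ! i ≡ w ! j → i ≡ j) where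
  open PositionOrder (forward {length w}) using (_≼_; _≺_)

  v : Pos w → ℕ
  v = w !_

  module Up = Mirror forward (upward k 1≤k) v
  module Down = Mirror forward (downward k 1≤k) v

  Section : Bool → Pos w → Pos w → Set
  Section true = KDescending k w
  Section false = KAscending k w

  MaximalSection : Bool → Pos w → Pos w → Set
  MaximalSection d = Maximal (Section d)

  -- y lies on side d of t, by less than k
  Near : Bool → Pos w → Pos w → Set
  Near true = Up.Stays
  Near false = Down.Stays

  section? : ∀ d i j → Dec (Section d i j)
  section? true = Down.Rising?
  section? false = Up.Rising?

  extend-section : ∀ d {i j} → Section d i j →
                   ∃₂ λ i′ j′ → i′ ≼ i × j ≼ j′ × MaximalSection d i′ j′
  extend-section d = extend-to-maximal (section? d)

  section-< : ∀ d {i j} → Section d i j → i ≺ j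
  section-< true = proj₁
  section-< false = proj₁

  maximal-< : ∀ d {i j} → MaximalSection d i j → i ≺ j
  maximal-< d = section-< d ∘ proj₁

  Step : Bool → Pos w → Pos w → Set
  Step true x y = v y + k ≤ v x
  Step false x y = v x + k ≤ v y

  section-step : ∀ d {i j} → Section d i j → Step d i j
  section-step true = proj₁ ∘ proj₂ ∘ proj₂
  section-step false = proj₁ ∘ proj₂ ∘ proj₂

  section-merge : ∀ d {i j i′ j′} → Section d i j → Section d i′ j′ → i ≼ i′ → i′ ≼ j → j ≼ j′ → Section d i j′
  section-merge true = Down.rising-merge
  section-merge false = Up.rising-merge

  maximal-overlap-ordered : ∀ d {i j i′ j′} → MaximalSection d i j → MaximalSection d i′ j′ →
                            i ≼ i′ → i′ ≼ j → i ≡ i′ × j ≡ j′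
  maximal-overlap-ordered d {i} {j} {i′} {j′} m@(s , _) (s′ , maximal′) i≼i′ i′≼j with ≤-<-connex (toℕ j) (toℕ j′)
  ... | inj₂ j′<j = maximal′ i j i≼i′ (<⇒≤ j′<j) s
  ... | inj₁ j≼j′ = proj₁ (maximal′ i j i≼i′ (≤-reflexive (cong toℕ j′≡j)) s) , sym j′≡j
    where
      j′≡j : j′ ≡ j
      j′≡j = proj₂ (proj₂ m i j′ ≤-refl j≼j′ (section-merge d s s′ i≼i′ i′≼j j≼j′))

  maximal-overlap-same : ∀ d {i j i′ j′} → MaximalSection d i j → MaximalSection d i′ j′ →
                         i ≼ j′ → i′ ≼ j → i ≡ i′ × j ≡ j′
  maximal-overlap-same d {i} {j} {i′} m m′ i≼j′ i′≼j with ≤-<-connex (toℕ i) (toℕ i′)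
  ... | inj₁ i≼i′ = maximal-overlap-ordered d m m′ i≼i′ i′≼j
  ... | inj₂ i′<i with maximal-overlap-ordered d m′ m (<⇒≤ i′<i) i≼j′
  ...   | i′≡i , j′≡j = sym i′≡i , sym j′≡j

  maximal-overlap-opposite : ∀ d {i j i′ j′} → MaximalSection d i j → MaximalSection (not d) i′ j′ →
                             i ≼ j′ → i′ ≼ j → i′ ≡ j ⊎ j′ ≡ i
  maximal-overlap-opposite true m m′ = Down.rising-falling-overlap injective (proj₁ m) (proj₁ m′)
  maximal-overlap-opposite false m m′ = Up.rising-falling-overlap injective (proj₁ m) (proj₁ m′)

  after-maximal-section : ∀ d {a p} → MaximalSection d a p →
                          (∀ g → p ≺ g → Near (not d) p g) ⊎ ∃ (Section (not d) p)
  after-maximal-section true m = Down.after-maximal-rise (proj₁ m) (maximal-right m)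
  after-maximal-section false m = Up.after-maximal-rise (proj₁ m) (maximal-right m)

  before-maximal-section : ∀ d {p q} → MaximalSection d p q →
                           (∀ g → g ≺ p → Near d p g) ⊎ ∃ λ f → Section (not d) f p
  before-maximal-section true m =
    Data.Sum.map₂ (Data.Product.map₂ Up.reversed-falling⇒rising)
      (Up.Reversed.after-maximal-rise (Up.falling⇒reversed-rising (proj₁ m))
        (λ g g<p s → maximal-left m g g<p (Up.reversed-rising⇒falling s)))
  before-maximal-section false m =
    Data.Sum.map₂ (Data.Product.map₂ Down.reversed-falling⇒rising)
      (Down.Reversed.after-maximal-rise (Down.falling⇒reversed-rising (proj₁ m))
        (λ g g<p s → maximal-left m g g<p (Down.reversed-rising⇒falling s)))

  maximal-overlap : ∀ d d′ {i j i′ j′} → MaximalSection d i j → MaximalSection d′ i′ j′ →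
                    i ≼ j′ → i′ ≼ j → (i ≡ i′ × j ≡ j′) ⊎ (i′ ≡ j ⊎ j′ ≡ i)
  maximal-overlap true true m m′ i≼j′ i′≼j = inj₁ (maximal-overlap-same true m m′ i≼j′ i′≼j)
  maximal-overlap false false m m′ i≼j′ i′≼j = inj₁ (maximal-overlap-same false m m′ i≼j′ i′≼j)
  maximal-overlap true false m m′ i≼j′ i′≼j = inj₂ (maximal-overlap-opposite true m m′ i≼j′ i′≼j)
  maximal-overlap false true m m′ i≼j′ i′≼j = inj₂ (maximal-overlap-opposite false m m′ i≼j′ i′≼j)

  near-refl : ∀ d t → Near d t t
  near-refl true t = ≤-refl , +-gap-irrefl k 1≤k
  near-refl false t = ≤-refl , +-gap-irrefl k 1≤k

  near-close : ∀ d {t x y} → Near d t x → Near d t y → ¬ v x + k ≤ v y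
  near-close true (_ , x-close) (y≤t , _) x+k≤y = x-close (≤-trans x+k≤y y≤t)
  near-close false (t≤x , _) (_ , y-close) x+k≤y = y-close (≤-trans (+-monoˡ-≤ k t≤x) x+k≤y)

  near-after : ∀ d {p} → (∀ g → p ≺ g → Near d p g) → ∀ g → p ≼ g → Near d p g
  near-after d near g p≼g with m≤n⇒m<n∨m≡n p≼g
  ... | inj₁ p≺g = near g p≺g
  ... | inj₂ p≡g rewrite toℕ-injective p≡g = near-refl d g

  near-before : ∀ d {p} → (∀ g → g ≺ p → Near d p g) → ∀ g → g ≼ p → Near d p g
  near-before d near g g≼p with m≤n⇒m<n∨m≡n g≼p
  ... | inj₁ g≺p = near g g≺p
  ... | inj₂ g≡p rewrite toℕ-injective g≡p = near-refl d _

  near-no-step : ∀ d e {t x y} → Near d t x → Near d t y → ¬ Step e x y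
  near-no-step d true near-x near-y = near-close d near-y near-x
  near-no-step d false near-x near-y = near-close d near-x near-y

  no-section-near : ∀ d {p} → (∀ g → p ≼ g → Near d p g) → ∀ d′ {x y} → p ≼ x → ¬ Section d′ x y
  no-section-near d near d′ {x} {y} p≼x s =
    near-no-step d d′ (near x p≼x) (near y (≤-trans p≼x (<⇒≤ (section-< d′ s)))) (section-step d′ s)

  Turning : Pos w → Set
  Turning p = KPeak k w p ⊎ KValley k w p

  start-turning : ∀ d {p q} → MaximalSection d p q → Turning p
  start-turning true m = inj₁ (inj₂ (_ , m))
  start-turning false m = inj₂ (inj₁ (_ , m))

  end-turning : ∀ d {a p} → MaximalSection d a p → Turning p
  end-turning true m = inj₂ (inj₂ (_ , m))
  end-turning false m = inj₁ (inj₁ (_ , m))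

  Endpoint : Pos w → Set
  Endpoint z = ∃[ d ] ∃[ x ] ∃[ y ] MaximalSection d x y × (z ≡ x ⊎ z ≡ y)

  turning-endpoint : ∀ {z} → Turning z → Endpoint z
  turning-endpoint (inj₁ (inj₁ (a , m))) = false , a , _ , m , inj₂ refl
  turning-endpoint (inj₁ (inj₂ (q , m))) = true , _ , q , m , inj₁ refl
  turning-endpoint (inj₂ (inj₁ (q , m))) = false , _ , q , m , inj₁ refl
  turning-endpoint (inj₂ (inj₂ (a , m))) = true , a , _ , m , inj₂ refl

  endpoint-between : ∀ d {x y z} → MaximalSection d x y → z ≡ x ⊎ z ≡ y → x ≼ z × z ≼ y
  endpoint-between d m (inj₁ refl) = ≤-refl , <⇒≤ (maximal-< d m)
  endpoint-between d m (inj₂ refl) = <⇒≤ (maximal-< d m) , ≤-refl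

  no-turning-inside : ∀ d {p q z} → MaximalSection d p q → Turning z → p ≺ z → z ≺ q → ⊥
  no-turning-inside d {p} {q} {z} m tz p≺z z≺q with turning-endpoint tz
  ... | d′ , x , y , m′ , z≡x⊎y with endpoint-between d′ m′ z≡x⊎y
  ...   | x≼z , z≼y with maximal-overlap d d′ m m′ (≤-trans (<⇒≤ p≺z) z≼y) (≤-trans x≼z (<⇒≤ z≺q)) | z≡x⊎y
  ...     | inj₁ (refl , _) | inj₁ refl = <-irrefl refl p≺z
  ...     | inj₁ (_ , refl) | inj₂ refl = <-irrefl refl z≺q
  ...     | inj₂ (inj₁ refl) | _ = <-irrefl refl (≤-<-trans x≼z z≺q)
  ...     | inj₂ (inj₂ refl) | _ = <-irrefl refl (<-≤-trans p≺z z≼y)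

  starts-after-maximal : ∀ d d′ {a p x y} → MaximalSection d a p → MaximalSection d′ x y → p ≺ y → p ≼ x
  starts-after-maximal d d′ {a} {p} {x} {y} m m′ p≺y with ≤-<-connex (toℕ p) (toℕ x)
  ... | inj₁ p≼x = p≼x
  ... | inj₂ x≺p with maximal-overlap d d′ m m′ (<⇒≤ a≺y) (<⇒≤ x≺p)
    where a≺y = <-trans (maximal-< d m) p≺y
  ...   | inj₁ (_ , refl) = ⊥-elim (<-irrefl refl p≺y)
  ...   | inj₂ (inj₁ refl) = ⊥-elim (<-irrefl refl x≺p)
  ...   | inj₂ (inj₂ refl) = ⊥-elim (<-irrefl refl (<-trans (maximal-< d m) p≺y))

  section-after-maximal : ∀ d {a p z} → MaximalSection d a p → Turning z → p ≺ z →
                          ∃[ q ] MaximalSection (not d) p q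
  section-after-maximal d {a} {p} m tz p≺z with after-maximal-section d m
  ... | inj₂ (f , s) with extend-section (not d) s
  ...   | i′ , j′ , i′≼p , f≼j′ , m′ with maximal-overlap-opposite d m m′ (<⇒≤ a≺j′) i′≼p
    where a≺j′ = <-trans (maximal-< d m) (<-≤-trans (section-< (not d) s) f≼j′)
  ...     | inj₁ refl = j′ , m′
  ...     | inj₂ refl = ⊥-elim (<-irrefl refl (<-trans (maximal-< d m) (<-≤-trans (section-< (not d) s) f≼j′)))
  section-after-maximal d m tz p≺z | inj₁ near with turning-endpoint tz
  ... | d′ , x , y , m′ , z≡x⊎y = ⊥-elim $
        no-section-near (not d) (near-after (not d) near) d′ (starts-after-maximal d d′ m m′ p≺y) (proj₁ m′)
    where p≺y = <-≤-trans p≺z (proj₂ (endpoint-between d′ m′ z≡x⊎y))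

  section-from-turning : ∀ {p z} → Turning p → Turning z → p ≺ z → ∃[ d ] ∃[ q ] MaximalSection d p q
  section-from-turning tp tz p≺z with turning-endpoint tp
  ... | d , _ , q , m , inj₁ refl = d , q , m
  ... | d , _ , _ , m , inj₂ refl = not d , section-after-maximal d m tz p≺z

  section-to-next-turning : ∀ {p p′} → Turning p → Turning p′ → p ≺ p′ →
                            (∀ z → Turning z → p ≺ z → p′ ≼ z) → ∃[ d ] MaximalSection d p p′
  section-to-next-turning {p} {p′} tp tp′ p≺p′ next with section-from-turning tp tp′ p≺p′
  ... | d , q , m with m≤n⇒m<n∨m≡n (next q (end-turning d m) (maximal-< d m))
  ...   | inj₁ p′≺q = ⊥-elim (no-turning-inside d m tp′ p≺p′ p′≺q)
  ...   | inj₂ p′≡q rewrite toℕ-injective p′≡q = d , m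

  maximal-not-repeated : ∀ d {a p q} → MaximalSection d a p → ¬ MaximalSection d p q
  maximal-not-repeated d m m′ =
    <-irrefl (cong toℕ (proj₁ (maximal-overlap-same d m m′ (<⇒≤ (<-trans (maximal-< d m) (maximal-< d m′))) ≤-refl)))
             (maximal-< d m)

  alternate : ∀ d d′ {a p q} → MaximalSection d a p → MaximalSection d′ p q → MaximalSection (not d) p q
  alternate true false _ m′ = m′
  alternate false true _ m′ = m′
  alternate true true m m′ = ⊥-elim (maximal-not-repeated true m m′)
  alternate false false m m′ = ⊥-elim (maximal-not-repeated false m m′)

  Increasing : List (Pos w) → Set
  Increasing = Linked _≺_

  after-head : ∀ {t S z} → Increasing (t ∷ S) → z ∈ S → t ≺ z
  after-head (t≺t′ ∷ increasing) = All.lookup (LinkedP.Linked⇒All <-trans t≺t′ increasing)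

  head-≼ : ∀ {t S z} → Increasing (t ∷ S) → z ∈ t ∷ S → t ≼ z
  head-≼ _ (here refl) = ≤-refl
  head-≼ increasing (there z∈S) = <⇒≤ (after-head increasing z∈S)

  -- Consecutive entries are joined by sections of alternating directions, starting with d; everything
  -- after the last entry is near it on the side of the direction that would come next.
  Chain : Bool → List (Pos w) → Set
  Chain d [] = ⊤
  Chain d (t ∷ []) = ∀ y → t ≼ y → Near d t y
  Chain d (t ∷ t′ ∷ r) = Section d t t′ × Chain (not d) (t′ ∷ r)

  chain-after-maximal : ∀ d {a t} S → MaximalSection d a t → Increasing (t ∷ S) →
                        (∀ z → Turning z → t ≺ z → z ∈ S) → All Turning S → Chain (not d) (t ∷ S)
  chain-after-maximal d [] m _ later _ with after-maximal-section d m
  ... | inj₁ near = near-after (not d) near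
  ... | inj₂ (f , s) with extend-section (not d) s
  ...   | _ , j′ , _ , f≼j′ , m′ with later j′ (end-turning (not d) m′) (<-≤-trans (section-< (not d) s) f≼j′)
  ...     | ()
  chain-after-maximal d {t = t} (t′ ∷ S) m increasing@(t≺t′ ∷ increasing′) later (turning-t′ ∷ turning-S)
    with section-to-next-turning (end-turning d m) turning-t′ t≺t′ next
    where
      next : ∀ z → Turning z → t ≺ z → t′ ≼ z
      next z tz t≺z = head-≼ increasing′ (later z tz t≺z)
  ... | d′ , m′ = proj₁ m″ , chain-after-maximal (not d) S m″ increasing′ later′ turning-S
    where
      m″ = alternate d d′ m m′
      later′ : ∀ z → Turning z → t′ ≺ z → z ∈ S
      later′ z tz t′≺z with later z tz (<-trans t≺t′ t′≺z)
      ... | here refl = ⊥-elim (<-irrefl refl t′≺z)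
      ... | there z∈S = z∈S

  turning-chain : ∀ t₁ t₂ r → Increasing (t₁ ∷ t₂ ∷ r) → (∀ z → (z ∈ t₁ ∷ t₂ ∷ r) ⇔ Turning z) →
                  ∃[ d ] (∀ x → x ≼ t₁ → Near d t₁ x) × Chain d (t₁ ∷ t₂ ∷ r)
  turning-chain t₁ t₂ r increasing@(t₁≺t₂ ∷ increasing′) turning
    with section-to-next-turning (turning-of (here refl)) (turning-of (there (here refl))) t₁≺t₂ next
    where
      turning-of : ∀ {z} → z ∈ t₁ ∷ t₂ ∷ r → Turning z
      turning-of = Equivalence.to (turning _)
      next : ∀ z → Turning z → t₁ ≺ z → t₂ ≼ z
      next z tz t₁≺z with Equivalence.from (turning z) tz
      ... | here refl = ⊥-elim (<-irrefl refl t₁≺z)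
      ... | there z∈ = head-≼ increasing′ z∈
  ... | d , m = d , before , proj₁ m , chain-after-maximal d r m increasing′ later turning-r
    where
      before : ∀ x → x ≼ t₁ → Near d t₁ x
      before with before-maximal-section d m
      ... | inj₁ near = near-before d near
      ... | inj₂ (f , s) with extend-section (not d) s
      ...   | i′ , _ , i′≼f , _ , m′ = ⊥-elim (<⇒≱ (≤-<-trans i′≼f (section-< (not d) s)) t₁≼i′)
        where t₁≼i′ = head-≼ increasing (Equivalence.from (turning i′) (start-turning (not d) m′))
      later : ∀ z → Turning z → t₂ ≺ z → z ∈ r
      later z tz t₂≺z with Equivalence.from (turning z) tz
      ... | here refl = ⊥-elim (<-asym t₂≺z t₁≺t₂)
      ... | there (here refl) = ⊥-elim (<-irrefl refl t₂≺z)
      ... | there (there z∈r) = z∈r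
      turning-r : All Turning r
      turning-r = All.tabulate λ z∈r → Equivalence.to (turning _) (there (there z∈r))

  no-step-against : ∀ d {t t′ x y} → Section d t t′ → t ≼ x → x ≺ y → y ≼ t′ → ¬ Step (not d) x y
  no-step-against true (_ , _ , _ , no-rise) t≼x x≺y y≼t′ = no-rise _ _ t≼x x≺y y≼t′
  no-step-against false (_ , _ , _ , no-fall) t≼x x≺y y≼t′ = no-fall _ _ t≼x x≺y y≼t′

  length-≤-potential : (R : Bool → Pos w → ℕ) → (∀ e x → 1 ≤ R e x) →
                       (∀ e {x y} → x ≺ y → Step e x y → suc (R (not e) y) ≤ R e x) →
                       ∀ e x Q → Increasing (x ∷ Q) → AltFrom e (map v (x ∷ Q)) → KGaps k (map v (x ∷ Q)) →
                       length (x ∷ Q) ≤ R e x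
  length-≤-potential R positive decreasing e x [] _ _ _ = positive e x
  length-≤-potential R positive decreasing true x (y ∷ Q) (x≺y ∷ increasing) (y<x , alternating) (gap , gaps) =
    ≤-trans (s≤s (length-≤-potential R positive decreasing false y Q increasing alternating gaps))
            (decreasing true x≺y (m≤n∧o≤∣m-n∣⇒m+o≤n (<⇒≤ y<x) (subst (k ≤_) (∣-∣-comm (v x) (v y)) gap)))
  length-≤-potential R positive decreasing false x (y ∷ Q) (x≺y ∷ increasing) (x<y , alternating) (gap , gaps) =
    ≤-trans (s≤s (length-≤-potential R positive decreasing true y Q increasing alternating gaps))
            (decreasing false x≺y (m≤n∧o≤∣m-n∣⇒m+o≤n (<⇒≤ x<y) gap))

  -- For x ≽ t, where t ∷ r are the turning points from t on and d is the direction of the section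
  -- leaving t: the turning points after x, plus the one opening the section containing x if that
  -- section runs in the direction e of the next step; after the last turning point it is 1.
  potential : Bool → Pos w → List (Pos w) → Bool → Pos w → ℕ
  potential d t [] e x = 1
  potential d t (t′ ∷ r) e x with toℕ x <? toℕ t′
  ... | yes _ = if e xor d then length (t′ ∷ r) else length (t ∷ t′ ∷ r)
  ... | no _ = potential (not d) t′ r e x

  potential-≤-length : ∀ d t r e x → potential d t r e x ≤ length (t ∷ r)
  potential-≤-length d t [] e x = ≤-refl
  potential-≤-length d t (t′ ∷ r) e x with toℕ x <? toℕ t′
  ... | no _ = m≤n⇒m≤1+n (potential-≤-length (not d) t′ r e x)
  ... | yes _ with e xor d
  ...   | true = n≤1+n _
  ...   | false = ≤-refl

  potential-positive : ∀ d t r e x → 1 ≤ potential d t r e x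
  potential-positive d t [] e x = ≤-refl
  potential-positive d t (t′ ∷ r) e x with toℕ x <? toℕ t′
  ... | no _ = potential-positive (not d) t′ r e x
  ... | yes _ with e xor d
  ...   | true = s≤s z≤n
  ...   | false = s≤s z≤n

  potential-against : ∀ d t t′ r e x → e xor d ≡ true → suc (potential d t (t′ ∷ r) e x) ≤ length (t ∷ t′ ∷ r)
  potential-against d t t′ r e x against with toℕ x <? toℕ t′
  ... | yes _ rewrite against = ≤-refl
  ... | no _ = s≤s (potential-≤-length (not d) t′ r e x)

  step-within : ∀ d e {t t′ x y} n → Section d t t′ → t ≼ x → x ≺ y → y ≼ t′ → Step e x y →
                suc (if not e xor d then n else suc n) ≤ (if e xor d then n else suc n)
  step-within true true n _ _ _ _ _ = ≤-refl
  step-within false false n _ _ _ _ _ = ≤-refl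
  step-within true false n s t≼x x≺y y≼t′ = ⊥-elim ∘ no-step-against true s t≼x x≺y y≼t′
  step-within false true n s t≼x x≺y y≼t′ = ⊥-elim ∘ no-step-against false s t≼x x≺y y≼t′

  step-leaving : ∀ d e {t t′ x y} r → Section d t t′ → Chain (not d) (t′ ∷ r) →
                 t ≼ x → x ≺ t′ → t′ ≼ y → Step e x y →
                 suc (potential (not d) t′ r (not e) y) ≤ (if e xor d then length (t′ ∷ r) else length (t ∷ t′ ∷ r))
  step-leaving true true r _ _ _ _ _ _ = s≤s (potential-≤-length false _ r false _)
  step-leaving false false r _ _ _ _ _ _ = s≤s (potential-≤-length true _ r true _)
  step-leaving true false (t″ ∷ r) _ _ _ _ _ _ = potential-against false _ t″ r true _ refl
  step-leaving false true (t″ ∷ r) _ _ _ _ _ _ = potential-against true _ t″ r false _ refl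
  step-leaving true false [] (_ , bounds , _) near t≼x x≺t′ t′≼y x+k≤y = ⊥-elim $
    proj₂ (near _ t′≼y) (≤-trans (+-monoˡ-≤ k (proj₂ (bounds _ t≼x (<⇒≤ x≺t′)))) x+k≤y)
  step-leaving false true [] (_ , bounds , _) near t≼x x≺t′ t′≼y y+k≤x = ⊥-elim $
    proj₂ (near _ t′≼y) (≤-trans y+k≤x (proj₂ (bounds _ t≼x (<⇒≤ x≺t′))))

  potential-decreases : ∀ d t r → Chain d (t ∷ r) → ∀ e {x y} → t ≼ x → x ≺ y → Step e x y →
                        suc (potential d t r (not e) y) ≤ potential d t r e x
  potential-decreases d t [] near e t≼x x≺y =
    ⊥-elim ∘ near-no-step d e (near _ t≼x) (near _ (≤-trans t≼x (<⇒≤ x≺y)))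
  potential-decreases d t (t′ ∷ r) (section , chain) e {x} {y} t≼x x≺y step
    with toℕ y <? toℕ t′ | toℕ x <? toℕ t′
  ... | yes y≺t′ | no x⊀t′ = ⊥-elim (x⊀t′ (<-trans x≺y y≺t′))
  ... | no y⊀t′ | no x⊀t′ = potential-decreases (not d) t′ r chain e (≮⇒≥ x⊀t′) x≺y step
  ... | yes y≺t′ | yes _ = step-within d e (length (t′ ∷ r)) section t≼x x≺y (<⇒≤ y≺t′) step
  ... | no y⊀t′ | yes x≺t′ = step-leaving d e r section chain t≼x x≺t′ (≮⇒≥ y⊀t′) step

  -- Before the first turning point t, all turning points are still usable.
  total-potential : Bool → Pos w → List (Pos w) → Bool → Pos w → ℕ
  total-potential d t r e x with toℕ x <? toℕ t
  ... | yes _ = length (t ∷ r)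
  ... | no _ = potential d t r e x

  total-potential-≤-length : ∀ d t r e x → total-potential d t r e x ≤ length (t ∷ r)
  total-potential-≤-length d t r e x with toℕ x <? toℕ t
  ... | yes _ = ≤-refl
  ... | no _ = potential-≤-length d t r e x

  total-potential-positive : ∀ d t r e x → 1 ≤ total-potential d t r e x
  total-potential-positive d t r e x with toℕ x <? toℕ t
  ... | yes _ = s≤s z≤n
  ... | no _ = potential-positive d t r e x

  step-entering : ∀ d e {t₁ t₂ x y} n → Section d t₁ t₂ → Near d t₁ x → t₁ ≼ y → y ≼ t₂ → Step e x y →
                  suc (if not e xor d then n else suc n) ≤ suc n
  step-entering true true n _ _ _ _ _ = ≤-refl
  step-entering false false n _ _ _ _ _ = ≤-refl
  step-entering true false n (_ , bounds , _) (_ , x-close) t₁≼y y≼t₂ x+k≤y =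
    ⊥-elim (x-close (≤-trans x+k≤y (proj₁ (bounds _ t₁≼y y≼t₂))))
  step-entering false true n (_ , bounds , _) (t₁≤x , x-close) t₁≼y y≼t₂ y+k≤x =
    ⊥-elim (x-close (≤-trans (+-monoˡ-≤ k (proj₁ (bounds _ t₁≼y y≼t₂))) y+k≤x))

  total-potential-decreases : ∀ d t₁ t₂ r → (∀ x → x ≼ t₁ → Near d t₁ x) → Chain d (t₁ ∷ t₂ ∷ r) →
                              ∀ e {x y} → x ≺ y → Step e x y →
                              suc (total-potential d t₁ (t₂ ∷ r) (not e) y) ≤ total-potential d t₁ (t₂ ∷ r) e x
  total-potential-decreases d t₁ t₂ r before chain e {x} {y} x≺y step with toℕ y <? toℕ t₁ | toℕ x <? toℕ t₁
  ... | yes y≺t₁ | no x⊀t₁ = ⊥-elim (x⊀t₁ (<-trans x≺y y≺t₁))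
  ... | no y⊀t₁ | no x⊀t₁ = potential-decreases d t₁ (t₂ ∷ r) chain e (≮⇒≥ x⊀t₁) x≺y step
  ... | yes y≺t₁ | yes x≺t₁ = ⊥-elim (near-no-step d e (before x (<⇒≤ x≺t₁)) (before y (<⇒≤ y≺t₁)) step)
  ... | no y⊀t₁ | yes x≺t₁ with toℕ y <? toℕ t₂
  ...   | no _ = s≤s (potential-≤-length (not d) t₂ r (not e) y)
  ...   | yes y≺t₂ =
          step-entering d e (length (t₂ ∷ r)) (proj₁ chain) (before x (<⇒≤ x≺t₁)) (≮⇒≥ y⊀t₁) (<⇒≤ y≺t₂) step

  chain-zigzag : ∀ d C → Chain d C → AltFrom d (map v C) × KGaps k (map v C)
  chain-zigzag d [] _ = tt , tt
  chain-zigzag d (t ∷ []) _ = tt , tt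
  chain-zigzag true (t ∷ t′ ∷ r) ((_ , _ , t′+k≤t , _) , chain) with chain-zigzag false (t′ ∷ r) chain
  ... | alternating , gaps =
        (<-≤-trans (m<m+n (v t′) 1≤k) t′+k≤t , alternating) ,
        (subst (k ≤_) (∣-∣-comm (v t′) (v t)) (m+o≤n⇒o≤∣m-n∣ t′+k≤t) , gaps)
  chain-zigzag false (t ∷ t′ ∷ r) ((_ , _ , t+k≤t′ , _) , chain) with chain-zigzag true (t′ ∷ r) chain
  ... | alternating , gaps = (<-≤-trans (m<m+n (v t) 1≤k) t+k≤t′ , alternating) , (m+o≤n⇒o≤∣m-n∣ t+k≤t′ , gaps)

  turning-zigzag-longest : ∀ t₁ t₂ r → Increasing (t₁ ∷ t₂ ∷ r) → (∀ z → (z ∈ t₁ ∷ t₂ ∷ r) ⇔ Turning z) →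
                           KZigzagSubseq k w (t₁ ∷ t₂ ∷ r) ×
                           (∀ Q → KZigzagSubseq k w Q → length Q ≤ length (t₁ ∷ t₂ ∷ r))
  turning-zigzag-longest t₁ t₂ r increasing turning with turning-chain t₁ t₂ r increasing turning
  ... | d , before , chain = (increasing , zigzag d (chain-zigzag d _ chain)) , longest
    where
      zigzag : ∀ d {xs} → AltFrom d xs × KGaps k xs → KZigzagging k xs
      zigzag true (alternating , gaps) = inj₁ alternating , gaps
      zigzag false (alternating , gaps) = inj₂ alternating , gaps
      bound : ∀ e x Q → Increasing (x ∷ Q) → AltFrom e (map v (x ∷ Q)) → KGaps k (map v (x ∷ Q)) →
              length (x ∷ Q) ≤ length (t₁ ∷ t₂ ∷ r)
      bound e x Q increasing′ alternating gaps = ≤-trans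
        (length-≤-potential (total-potential d t₁ (t₂ ∷ r)) (total-potential-positive d t₁ (t₂ ∷ r))
                            (total-potential-decreases d t₁ t₂ r before chain) e x Q increasing′ alternating gaps)
        (total-potential-≤-length d t₁ (t₂ ∷ r) e x)
      longest : ∀ Q → KZigzagSubseq k w Q → length Q ≤ length (t₁ ∷ t₂ ∷ r)
      longest [] _ = z≤n
      longest (x ∷ Q) (increasing′ , inj₁ alternating , gaps) = bound true x Q increasing′ alternating gaps
      longest (x ∷ Q) (increasing′ , inj₂ alternating , gaps) = bound false x Q increasing′ alternating gaps

  turning-points-longest-zigzag : (T : List (Pos w)) → Increasing T → (∀ z → (z ∈ T) ⇔ Turning z) →
                                  (∃[ d ] ∃[ i ] ∃[ j ] Section d i j) →
                                  KZigzagSubseq k w T × (∀ Q → KZigzagSubseq k w Q → length Q ≤ length T)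
  turning-points-longest-zigzag (t₁ ∷ t₂ ∷ r) increasing turning _ = turning-zigzag-longest t₁ t₂ r increasing turning
  turning-points-longest-zigzag [] _ turning (d , _ , _ , s) with extend-section d s
  ... | i , _ , _ , _ , m with Equivalence.from (turning i) (start-turning d m)
  ...   | ()
  turning-points-longest-zigzag (t ∷ []) _ turning (d , _ , _ , s) with extend-section d s
  ... | i , j , _ , _ , m
    with Equivalence.from (turning i) (start-turning d m) | Equivalence.from (turning j) (end-turning d m)
  ...   | here refl | here refl = ⊥-elim (<-irrefl refl (maximal-< d m))

  turning? : ∀ p → Dec (Turning p)
  turning? p = ((any? λ i → Maximal? (section? false) i p) ⊎-dec (any? λ j → Maximal? (section? true) p j))
        ⊎-dec ((any? λ j → Maximal? (section? false) p j) ⊎-dec (any? λ i → Maximal? (section? true) i p))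

  peak-not-valley : ∀ p → KPeak k w p → ¬ KValley k w p
  peak-not-valley p (inj₁ (_ , m)) (inj₁ (_ , m′)) = maximal-not-repeated false m m′
  peak-not-valley p (inj₂ (_ , m)) (inj₂ (_ , m′)) = maximal-not-repeated true m′ m
  peak-not-valley p (inj₁ (_ , m)) (inj₂ (_ , m′))
    with maximal-overlap-opposite false m m′ (<⇒≤ (maximal-< false m)) (<⇒≤ (maximal-< true m′))
  ... | inj₁ refl = <-irrefl refl (maximal-< true m′)
  ... | inj₂ refl = <-irrefl refl (maximal-< false m)
  peak-not-valley p (inj₂ (_ , m)) (inj₁ (_ , m′))
    with maximal-overlap-opposite false m′ m (<⇒≤ (maximal-< true m)) (<⇒≤ (maximal-< false m′))
  ... | inj₁ refl = <-irrefl refl (maximal-< false m′)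
  ... | inj₂ refl = <-irrefl refl (maximal-< true m)

  section-between-extremes : ∀ {a b} → (∀ g → v a ≤ v g) → (∀ g → v g ≤ v b) → v a + k ≤ v b →
                             ∃[ d ] ∃[ i ] ∃[ j ] Section d i j
  section-between-extremes {a} {b} minimum maximum gap with <-cmp (toℕ a) (toℕ b)
  ... | tri< a≺b _ _ = false , a , Up.rising-from-minimum minimum a≺b gap
  ... | tri> _ _ b≺a = true , b , Down.rising-from-minimum maximum b≺a gap
  ... | tri≈ _ a≡b _ rewrite toℕ-injective a≡b = ⊥-elim (+-gap-irrefl k 1≤k gap)

module Permutations (n : ℕ) where
  InRange : ℕ → Set
  InRange x = 1 ≤ x × x ≤ n

  ∈-range⇔ : ∀ {x} → (x ∈ applyUpTo suc n) ⇔ InRange x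
  ∈-range⇔ = mk⇔ to from
    where
      to : ∀ {x} → x ∈ applyUpTo suc n → InRange x
      to x∈ with ∈-applyUpTo⁻ suc x∈
      ... | _ , i<n , refl = s≤s z≤n , i<n
      from : ∀ {x} → InRange x → x ∈ applyUpTo suc n
      from {suc x} (_ , x<n) = ∈-applyUpTo⁺ suc x<n

  range-unique : Unique (applyUpTo suc n)
  range-unique = UniqueP.applyUpTo⁺₁ suc n λ i<j _ → <⇒≢ (s≤s i<j)

  perm-unique : ∀ {w} → IsPerm n w → Unique w
  perm-unique perm = Unique-resp-↭ (setoid ℕ) (↭⇒↭ₛ (↭-sym perm)) range-unique

  perm-∈⇔ : ∀ {w} → IsPerm n w → ∀ {x} → (x ∈ w) ⇔ InRange x
  perm-∈⇔ perm = ⇔-trans (mk⇔ (∈-resp-↭ perm) (∈-resp-↭ (↭-sym perm))) ∈-range⇔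

  range⇒perm : ∀ {w} → Unique w → (∀ {x} → (x ∈ w) ⇔ InRange x) → IsPerm n w
  range⇒perm unique members = unique-same-members⇒↭ unique range-unique (⇔-trans members (⇔-sym ∈-range⇔))

  complement : List ℕ → List ℕ
  complement = map (suc n ∸_)

  complement-in-range : ∀ {x} → InRange x → InRange (suc n ∸ x)
  complement-in-range (1≤x , x≤n) = m<n⇒0<n∸m (s≤s x≤n) , ∸-monoʳ-≤ (suc n) 1≤x

  complement-involutive : ∀ {x} → InRange x → suc n ∸ (suc n ∸ x) ≡ x
  complement-involutive (_ , x≤n) = m∸[m∸n]≡n (m≤n⇒m≤1+n x≤n)

  complement-complement : ∀ {w} → IsPerm n w → complement (complement w) ≡ w
  complement-complement {w} perm =
    trans (sym (map-∘ w)) (map-id-local (All.tabulate (complement-involutive ∘ Equivalence.to (perm-∈⇔ perm))))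

  complement-perm : ∀ {w} → IsPerm n w → IsPerm n (complement w)
  complement-perm {w} perm = range⇒perm unique (mk⇔ to from)
    where
      unique : Unique (complement w)
      unique = UniqueP.map⁻ (subst Unique (sym (complement-complement perm)) (perm-unique perm))
      to : ∀ {x} → x ∈ complement w → InRange x
      to x∈ with ∈-map⁻ (suc n ∸_) x∈
      ... | y , y∈w , refl = complement-in-range (Equivalence.to (perm-∈⇔ perm) y∈w)
      from : ∀ {x} → InRange x → x ∈ complement w
      from x-in-range = subst (_∈ complement w) (complement-involutive x-in-range)
        (∈-map⁺ (suc n ∸_) (Equivalence.from (perm-∈⇔ perm) (complement-in-range x-in-range)))

module Counting (n k : ℕ) (2≤n : 2 ≤ n) (1≤k : 1 ≤ k) (k≤n∸1 : k ≤ n ∸ 1) where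
  open Permutations n

  IsNumKValleys : List ℕ → ℕ → Set
  IsNumKValleys w m = Σ (List (Pos w)) λ vs → Unique vs × (∀ p → (p ∈ vs) ⇔ KValley k w p) × length vs ≡ m

  module _ {w : List ℕ} (perm : IsPerm n w) where
    open Zigzag k 1≤k w (lookup-injective (perm-unique perm))

    -- The entries 1 and n are at least k apart, which is where 2 ≤ n and k ≤ n − 1 are needed.
    section-exists : ∃[ d ] ∃[ i ] ∃[ j ] Section d i j
    section-exists = section-between-extremes minimum maximum gap
      where
        1≤n : 1 ≤ n
        1≤n = ≤-trans (s≤s z≤n) 2≤n
        one∈w : 1 ∈ w
        one∈w = Equivalence.from (perm-∈⇔ perm) (≤-refl , 1≤n)
        n∈w : n ∈ w
        n∈w = Equivalence.from (perm-∈⇔ perm) (1≤n , ≤-refl)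
        minimum : ∀ g → v (Any.index one∈w) ≤ v g
        minimum g = subst (_≤ v g) (lookup-index one∈w) (proj₁ (Equivalence.to (perm-∈⇔ perm) (∈-lookup g)))
        maximum : ∀ g → v g ≤ v (Any.index n∈w)
        maximum g = subst (v g ≤_) (lookup-index n∈w) (proj₂ (Equivalence.to (perm-∈⇔ perm) (∈-lookup g)))
        gap : v (Any.index one∈w) + k ≤ v (Any.index n∈w)
        gap = subst₂ (λ a b → a + k ≤ b) (lookup-index one∈w) (lookup-index n∈w)
                (subst (_≤ n) (+-comm k 1) (m≤o∸n⇒m+n≤o k 1≤n k≤n∸1))

    turning-points : List (Pos w)
    turning-points = filter turning? (allFin (length w))

    turning-points-increasing : Increasing turning-points
    turning-points-increasing = LinkedP.filter⁺ turning? <-trans (tabulate-increasing id id)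

    turning-points-unique : Unique turning-points
    turning-points-unique = UniqueP.filter⁺ turning? (UniqueP.allFin⁺ (length w))

    ∈-turning-points⇔ : ∀ z → (z ∈ turning-points) ⇔ Turning z
    ∈-turning-points⇔ z = mk⇔ (proj₂ ∘ ∈-filter⁻ turning? {xs = allFin (length w)}) (∈-filter⁺ turning? (∈-allFin z))

    longest-zigzag : (T : List (Pos w)) → IsSubseq w T → (∀ z → (z ∈ T) ⇔ Turning z) →
                     KZigzagSubseq k w T × (∀ Q → KZigzagSubseq k w Q → length Q ≤ length T)
    longest-zigzag T increasing members = turning-points-longest-zigzag T increasing members section-exists

    zs≡#turning-points : ∀ {z} → IsZs k w z → z ≡ length turning-points
    zs≡#turning-points ((Q , zigzag , length-Q) , longest) = ≤-antisym
      (subst (_≤ length turning-points) length-Q (proj₂ turning-longest Q zigzag))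
      (longest turning-points (proj₁ turning-longest))
      where turning-longest = longest-zigzag turning-points turning-points-increasing ∈-turning-points⇔

    complement-peaks⇒valleys : ∀ {q} → IsNumKPeaks k (complement w) q → IsNumKValleys w q
    complement-peaks⇒valleys {q} (ps , unique , members , length-ps) =
      map (Fin.cast eq) ps , UniqueP.map⁺ (cast-injective eq) unique , members′ ,
      trans (length-map (Fin.cast eq) ps) length-ps
      where
        eq : length (complement w) ≡ length w
        eq = length-map (suc n ∸_) w
        peak⇔valley : ∀ p → KPeak k (complement w) p ⇔ KValley k w (Fin.cast eq p)
        peak⇔valley = complement-peak⇔valley k 1≤k eq (suc n) (lookup w) (lookup (complement w))
          (lookup-map (suc n ∸_) w) (λ i → m≤n⇒m≤1+n (proj₂ (Equivalence.to (perm-∈⇔ perm) (∈-lookup i))))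
        members′ : ∀ z → (z ∈ map (Fin.cast eq) ps) ⇔ KValley k w z
        members′ z = mk⇔ to from
          where
            to : z ∈ map (Fin.cast eq) ps → KValley k w z
            to z∈ with ∈-map⁻ (Fin.cast eq) z∈
            ... | p , p∈ps , refl = Equivalence.to (peak⇔valley p) (Equivalence.to (members p) p∈ps)
            from : KValley k w z → z ∈ map (Fin.cast eq) ps
            from valley = subst (_∈ map (Fin.cast eq) ps) cast-cast (∈-map⁺ (Fin.cast eq) p∈ps)
              where
                p : Pos (complement w)
                p = Fin.cast (sym eq) z
                cast-cast : Fin.cast eq p ≡ z
                cast-cast = cast-involutive eq (sym eq) z
                valley′ : KValley k w (Fin.cast eq p)
                valley′ = subst (KValley k w) (sym cast-cast) valley
                p∈ps : p ∈ ps
                p∈ps = Equivalence.from (members p) (Equivalence.from (peak⇔valley p) valley′)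

    #turning-points≡peaks+valleys : ∀ {p q} → IsNumKPeaks k w p → IsNumKValleys w q → length turning-points ≡ p + q
    #turning-points≡peaks+valleys {p} {q} (ps , ps-unique , ∈ps⇔ , length-ps) (vs , vs-unique , ∈vs⇔ , length-vs) =
      begin
        length turning-points  ≡⟨ ↭-length turning↭peaks++valleys ⟩
        length (ps ++ vs)      ≡⟨ length-++ ps ⟩
        length ps + length vs  ≡⟨ cong₂ _+_ length-ps length-vs ⟩
        p + q                  ∎
      where
        open ≡-Reasoning
        disjoint : ∀ {z} → ¬ (z ∈ ps × z ∈ vs)
        disjoint {z} (z∈ps , z∈vs) = peak-not-valley z (Equivalence.to (∈ps⇔ z) z∈ps) (Equivalence.to (∈vs⇔ z) z∈vs)
        to : ∀ {z} → z ∈ turning-points → z ∈ ps ++ vs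
        to {z} z∈ = [ ∈-++⁺ˡ ∘ Equivalence.from (∈ps⇔ z) , ∈-++⁺ʳ ps ∘ Equivalence.from (∈vs⇔ z) ]
                      (Equivalence.to (∈-turning-points⇔ z) z∈)
        from : ∀ {z} → z ∈ ps ++ vs → z ∈ turning-points
        from {z} z∈ = Equivalence.from (∈-turning-points⇔ z)
          (Data.Sum.map (Equivalence.to (∈ps⇔ z)) (Equivalence.to (∈vs⇔ z)) (∈-++⁻ ps z∈))
        turning↭peaks++valleys : turning-points ↭ ps ++ vs
        turning↭peaks++valleys =
          unique-same-members⇒↭ turning-points-unique (UniqueP.++⁺ ps-unique vs-unique disjoint) (mk⇔ to from)

  zs≡peaks+complement-peaks : ∀ {w z p q} → IsPerm n w → IsZs k w z → IsNumKPeaks k w p →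
                              IsNumKPeaks k (complement w) q → z ≡ p + q
  zs≡peaks+complement-peaks perm zs peaks complement-peaks =
    trans (zs≡#turning-points perm zs)
          (#turning-points≡peaks+valleys perm peaks (complement-peaks⇒valleys perm complement-peaks))

  complement-permutes : ∀ {L} → EnumeratesSn n L → map complement L ↭ L
  complement-permutes {L} (perms , unique , complete) = unique-same-members⇒↭ unique′ unique (mk⇔ to from)
    where
      unique′ : Unique (map complement L)
      unique′ = UniqueP.map⁻ (subst Unique (sym complement-involutive-on-L) unique)
        where
          complement-involutive-on-L : map complement (map complement L) ≡ L
          complement-involutive-on-L =
            trans (sym (map-∘ L)) (map-id-local {f = complement ∘ complement} (All.map complement-complement perms))
      to : ∀ {u} → u ∈ map complement L → u ∈ L
      to u∈ with ∈-map⁻ complement u∈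
      ... | w , w∈L , refl = complete (complement w) (complement-perm (All.lookup perms w∈L))
      from : ∀ {u} → u ∈ L → u ∈ map complement L
      from {u} u∈L = subst (_∈ map complement L) (complement-complement perm)
                       (∈-map⁺ complement (complete (complement u) (complement-perm perm)))
        where perm = All.lookup perms u∈L

  sum-zs≡2*sum-peaks : (L : List (List ℕ)) → EnumeratesSn n L → (zs np : List ℕ → ℕ) →
                       (∀ w → IsPerm n w → IsZs k w (zs w)) → (∀ w → IsPerm n w → IsNumKPeaks k w (np w)) →
                       sum (map zs L) ≡ 2 * sum (map np L)
  sum-zs≡2*sum-peaks L enumerates@(perms , _) zs np zs-spec np-spec = begin
    sum (map zs L)
      ≡⟨ cong sum (map-cong-local (All.map split perms)) ⟩
    sum (map (λ w → np w + np (complement w)) L)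
      ≡⟨ sum-map-+ np (np ∘ complement) L ⟩
    sum (map np L) + sum (map (np ∘ complement) L)
      ≡⟨ cong (λ s → sum (map np L) + sum s) (map-∘ L) ⟩
    sum (map np L) + sum (map np (map complement L))
      ≡⟨ cong (sum (map np L) +_) (sum-↭ (↭-map⁺ np (complement-permutes enumerates))) ⟩
    sum (map np L) + sum (map np L)
      ≡⟨ cong (sum (map np L) +_) (+-identityʳ _) ⟨
    2 * sum (map np L)
      ∎
    where
      open ≡-Reasoning
      split : ∀ {w} → IsPerm n w → zs w ≡ np w + np (complement w)
      split {w} perm =
        zs≡peaks+complement-peaks perm (zs-spec w perm) (np-spec w perm) (np-spec (complement w) (complement-perm perm))

proposition2p8 : (n k : ℕ) → 2 ≤ n → 1 ≤ k → k ≤ n ∸ 1 →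
    ((w : List ℕ) → IsPerm n w →
      (P : List (Pos w)) → IsSubseq w P →
      (∀ p → (p ∈ P) ⇔ (KPeak k w p ⊎ KValley k w p)) →
      KZigzagSubseq k w P × (∀ Q → KZigzagSubseq k w Q → length Q ≤ length P))
    × ((L : List (List ℕ)) → EnumeratesSn n L →
      (zs np : List ℕ → ℕ) →
      (∀ w → IsPerm n w → IsZs k w (zs w)) →
      (∀ w → IsPerm n w → IsNumKPeaks k w (np w)) →
      sum (map zs L) ≡ 2 * sum (map np L))
proposition2p8 n k 2≤n 1≤k k≤n∸1 = (λ w perm → longest-zigzag perm) , sum-zs≡2*sum-peaks
  where open Counting n k 2≤n 1≤k k≤n∸1
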